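{- Let $U$ be a set, let $X=\{x_1,\dots,x_m\}$ and $Y=\{y_1,\dots,y_n\}$ be finite nonempty sets, and let $f: X\times Y\to P(U)$. Suppose $(x^*,y^*)\in X\times Y$ satisfies $\bigcup_{i=1}^m f(x_i,y^*)=f(x^*,y^*)=\bigcap_{j=1}^n f(x^*,y_j)$. Let $\underline{v}=\bigcup_{x\in X}\bigcap_{y\in Y} f(x,y)$ and $\overline{v}=\bigcap_{y\in Y}\bigcup_{x\in X} f(x,y)$. If $\underline{v}=\overline{v}=:v$, then $f(x^*,y^*)=v$.
   Context: $f$ is the soft payoff function of a two person soft game; $f(x^*,y^*)$ as in the hypothesis is called a soft saddle point; $\underline{v}$, $\overline{v}$ are the soft lower and soft upper values, and when equal their common value $v$ is the value of the game. -}

module Defs where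

open import Level using (Level)
open import Data.Nat using (ℕ; suc)
open import Data.Fin using (Fin)
open import Relation.Unary using (Pred; ⋃; ⋂)

-- A soft payoff function f : X × Y → P(U), with X = {x_1..x_m}, Y = {y_1..y_n}
-- finite nonempty (indexed by Fin m, Fin n with m, n ≥ 1); subsets of U are
-- predicates U → Set ℓ.

lowerValue : ∀ {u ℓ} {U : Set u} {m n : ℕ} →
             (Fin m → Fin n → Pred U ℓ) → Pred U ℓ
lowerValue {m = m} {n = n} f = ⋃ (Fin m) (λ i → ⋂ (Fin n) (λ j → f i j))

upperValue : ∀ {u ℓ} {U : Set u} {m n : ℕ} →
             (Fin m → Fin n → Pred U ℓ) → Pred U ℓ
upperValue {m = m} {n = n} f = ⋂ (Fin n) (λ j → ⋃ (Fin m) (λ i → f i j))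

module Submission where

-- Two general facts about the soft values sandwich f(x*,y*):
--   * every row intersection  ⋂ⱼ f(x,yⱼ)  is contained in the lower value
--     (it is one of the sets whose union is the lower value), and
--   * the upper value is contained in every column union  ⋃ᵢ f(xᵢ,y)
--     (it is the intersection of all of them).
-- Hence  upperValue f ⊆ f(x*,y*) ⊆ lowerValue f,  and when both values
-- equal v, f(x*,y*) = v.  No finiteness or nonemptiness is needed.

open import Defs
open import Data.Nat using (ℕ; suc)
open import Data.Fin using (Fin)
open import Data.Product using (_,_)
open import Relation.Unary using (Pred; ⋃; ⋂; _⊆_; _≐_)

rowIntersection⊆lowerValue : ∀ {u ℓ} {U : Set u} {m n : ℕ}
  (f : Fin m → Fin n → Pred U ℓ) (x : Fin m) →
  ⋂ (Fin n) (λ j → f x j) ⊆ lowerValue f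
rowIntersection⊆lowerValue f x z∈row = x , z∈row

upperValue⊆columnUnion : ∀ {u ℓ} {U : Set u} {m n : ℕ}
  (f : Fin m → Fin n → Pred U ℓ) (y : Fin n) →
  upperValue f ⊆ ⋃ (Fin m) (λ i → f i y)
upperValue⊆columnUnion f y z∈upper = z∈upper y

mainTheorem8 : ∀ {u ℓ} (U : Set u) (m n : ℕ)
    (f : Fin (suc m) → Fin (suc n) → Pred U ℓ)
    (xs : Fin (suc m)) (ys : Fin (suc n)) →
    ⋃ (Fin (suc m)) (λ i → f i ys) ≐ f xs ys →
    f xs ys ≐ ⋂ (Fin (suc n)) (λ j → f xs j) →
    (v : Pred U ℓ) →
    lowerValue f ≐ v →
    upperValue f ≐ v →
    f xs ys ≐ v
mainTheorem8 U m n f xs ys (column⊆saddle , _) (saddle⊆row , _) v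
             (lower⊆v , _) (_ , v⊆upper) =
  (λ z∈saddle → lower⊆v (rowIntersection⊆lowerValue f xs (saddle⊆row z∈saddle))) ,
  (λ z∈v → column⊆saddle (upperValue⊆columnUnion f ys (v⊆upper z∈v)))
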